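{- Let $\mathcal{R}$ be an LCSTRS, let $\succeq$ be a constrained relation such that $\ell\succeq r\ [\varphi\mid\mathrm{FV}(\varphi)\cup(\mathrm{FV}(r)\setminus\mathrm{FV}(\ell))]$ for every rule $\ell\to r\ [\varphi]\in\mathcal{R}$, and let $\sqsupseteq$ be a monotonic binary relation on terms which includes $\to_\kappa$ and covers $\succeq$. Then for all terms $t,t'$ with $t\to_{\mathcal{R}}t'$, we have $t{\downarrow_\kappa}\sqsupseteq^*t'{\downarrow_\kappa}$.
   Context: LCSTRSs. Fix sorts $\mathcal{S}$ with theory sorts $\mathcal{S}_{\mathrm{th}}$; types $\mathcal{T}::=\mathcal{S}\mid(\mathcal{T}\to\mathcal{T})$. Terms are well-typed applicative expressions (application $t_0\,t_1$, left-associative) over typed function symbols $\mathcal{F}$ and variables; $\mathrm{FV}(t)$ is the set of variables; ground means variable-free. Theory symbols $\mathcal{F}_{\mathrm{th}}\subseteq\mathcal{F}$ have types $S_1\to\cdots\to S_k$ with all $S_i\in\mathcal{S}_{\mathrm{th}}$; those of sort type are values; theory terms are built from theory symbols and variables. Each theory sort $A$ has a set $\mathfrak{X}_A$; an interpretation $[\![\cdot]\!]$ of theory symbols (bijective on values of each theory sort) extends to ground theory terms by $[\![t_0\,t_1]\!]=[\![t_0]\!]([\![t_1]\!])$; $\mathsf{bool}\in\mathcal{S}_{\mathrm{th}}$ with $\mathfrak{t},\mathfrak{f}\mapsto1,0$. A logical constraint is a $\mathsf{bool}$-typed theory term with theory-sorted variables. Substitutions are type-preserving maps from variables to terms; a context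 $C[\,]$ is a term with exactly one hole. A pattern is a term each of whose subterms is a variable or $f\,t_1\cdots t_n$ with $f\in\mathcal{F}$. A rule $\ell\to r\ [\varphi]$ has $\ell,r$ of the same type, $\varphi$ a logical constraint, theory-sorted variables in $\mathrm{FV}(r)\setminus\mathrm{FV}(\ell)$, and $\ell=f\,t_1\cdots t_n$ a pattern containing a symbol of $\mathcal{F}\setminus\mathcal{F}_{\mathrm{th}}$; $\sigma$ respects it if $\sigma(x)$ is a value for $x\in\mathrm{FV}(\varphi)\cup(\mathrm{FV}(r)\setminus\mathrm{FV}(\ell))$ and $[\![\varphi\sigma]\!]=1$. $\to_{\mathcal{R}}$ consists of $C[\ell\sigma]\to C[r\sigma]$ for rules of $\mathcal{R}$ and respecting $\sigma$, and calculation steps $C[f\,v_1\cdots v_n]\to_\kappa C[v']$ ($f$ theory symbol, $n>0$, values $v_i,v'$ with $[\![f\,v_1\cdots v_n]\!]=[\![v']\!]$); $\to_\kappa$ denotes the calculation steps alone, and $t{\downarrow_\kappa}$ is the unique $\to_\kappa$-normal form of $t$. A constrained relation $R$ is a set of quadruples $(s,t,\varphi,L)$ where $s,t$ are terms of the same type, $\varphi$ is a logical constraint and $L\supseteq\mathrm{FV}(\varphi)$ is a set of variables of theory sorts; write $s\,R\,t\ [\varphi\mid L]$. A binary relation $R'$ on terms covers $R$ if $s\,R\,t\ [\varphi\mid L]$ implies $(s\sigma){\downarrow_\kappa}\,R'\,(t\sigma){\downarrow_\kappa}$ for every substitution $\sigma$ such that $\sigma(x)$ is a ground theory term for all $x\in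 L$ and $[\![\varphi\sigma]\!]=1$. A relation $\sqsupseteq$ is monotonic if $s\sqsupseteq t$ implies $C[s]\sqsupseteq C[t]$ for all contexts $C$. -}

module Defs where

open import Data.Bool using (Bool; true; false; T)
open import Data.Empty using (⊥)
open import Data.Product using (Σ; _×_; _,_)
open import Data.Sum using (_⊎_)
open import Relation.Nullary using (¬_)
open import Relation.Binary.PropositionalEquality using (_≡_; subst)
open import Relation.Binary.Construct.Closure.ReflexiveTransitive using (Star)
open import Function using (id)

data Ty (Sort : Set) : Set where
  base : Sort → Ty Sort
  _⇒_  : Ty Sort → Ty Sort → Ty Sort
infixr 5 _⇒_

ThType : {Sort : Set} → (Sort → Bool) → Ty Sort → Set
ThType p (base S)            = T (p S)
ThType p (base S ⇒ B)        = T (p S) × ThType p B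
ThType p ((_ ⇒ _) ⇒ _)       = ⊥

TyI : {Sort : Set} → (Sort → Set) → Ty Sort → Set
TyI 𝔛 (base S) = 𝔛 S
TyI 𝔛 (A ⇒ B)  = TyI 𝔛 A → TyI 𝔛 B

record Signature : Set₁ where
  field
    Sort      : Set
    isThSort  : Sort → Bool
    bool      : Sort
    bool-th   : T (isThSort bool)
    Fun       : Ty Sort → Set
    isTh      : ∀ {A} → Fun A → Bool
    th-type   : ∀ {A} (f : Fun A) → T (isTh f) → ThType isThSort A
    Var       : Ty Sort → Set
    𝔛         : Sort → Set
    𝔛-bool    : 𝔛 bool ≡ Bool
    interp    : ∀ {A} (f : Fun A) → T (isTh f) → TyI 𝔛 A
    interp-inj  : ∀ {S} → T (isThSort S) → (f g : Fun (base S))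
                  (pf : T (isTh f)) (pg : T (isTh g)) →
                  interp f pf ≡ interp g pg → f ≡ g
    interp-surj : ∀ {S} → T (isThSort S) → (a : 𝔛 S) →
                  Σ (Fun (base S)) λ f → Σ (T (isTh f)) λ p → interp f p ≡ a
    𝔱 𝔣       : Fun (base bool)
    𝔱-th      : T (isTh 𝔱)
    𝔣-th      : T (isTh 𝔣)
    𝔱-interp  : subst id 𝔛-bool (interp 𝔱 𝔱-th) ≡ true
    𝔣-interp  : subst id 𝔛-bool (interp 𝔣 𝔣-th) ≡ false

module LCSTRSDefs (𝒮 : Signature) where
  open Signature 𝒮

  TyS : Set
  TyS = Ty Sort

  data Tm : TyS → Set where
    var : ∀ {A} → Var A → Tm A
    fun : ∀ {A} → Fun A → Tm A
    app : ∀ {A B} → Tm (A ⇒ B) → Tm A → Tm B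

  data _∈FV_ {A : TyS} (x : Var A) : ∀ {B} → Tm B → Set where
    here  : x ∈FV var x
    left  : ∀ {B C} {s : Tm (B ⇒ C)} {t : Tm B} → x ∈FV s → x ∈FV app s t
    right : ∀ {B C} {s : Tm (B ⇒ C)} {t : Tm B} → x ∈FV t → x ∈FV app s t

  VarSet : Set₁
  VarSet = ∀ {A} → Var A → Set

  IsThSortTy : TyS → Set
  IsThSortTy (base S) = T (isThSort S)
  IsThSortTy (_ ⇒ _)  = ⊥

  Subst : Set
  Subst = ∀ {A} → Var A → Tm A

  _[_] : ∀ {A} → Tm A → Subst → Tm A
  var x   [ σ ] = σ x
  fun f   [ σ ] = fun f
  app s t [ σ ] = app (s [ σ ]) (t [ σ ])

  data Ctx (B : TyS) : TyS → Set where
    □    : Ctx B B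
    appˡ : ∀ {A C} → Ctx B (A ⇒ C) → Tm A → Ctx B C
    appʳ : ∀ {A C} → Tm (A ⇒ C) → Ctx B A → Ctx B C

  _⟨_⟩ : ∀ {A B} → Ctx B A → Tm B → Tm A
  □        ⟨ u ⟩ = u
  appˡ C t ⟨ u ⟩ = app (C ⟨ u ⟩) t
  appʳ s C ⟨ u ⟩ = app s (C ⟨ u ⟩)

  data HeadFun : ∀ {A} → Tm A → Set where
    hfun : ∀ {A} (f : Fun A) → HeadFun (fun f)
    happ : ∀ {A B} {s : Tm (A ⇒ B)} {t : Tm A} → HeadFun s → HeadFun (app s t)

  data Pattern : ∀ {A} → Tm A → Set where
    pvar : ∀ {A} (x : Var A) → Pattern (var x)
    pfun : ∀ {A} (f : Fun A) → Pattern (fun f)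
    papp : ∀ {A B} {s : Tm (A ⇒ B)} {t : Tm A} →
           HeadFun s → Pattern s → Pattern t → Pattern (app s t)

  data HasNonTh : ∀ {A} → Tm A → Set where
    nfun   : ∀ {A} (f : Fun A) → isTh f ≡ false → HasNonTh (fun f)
    nleft  : ∀ {A B} {s : Tm (A ⇒ B)} {t : Tm A} → HasNonTh s → HasNonTh (app s t)
    nright : ∀ {A B} {s : Tm (A ⇒ B)} {t : Tm A} → HasNonTh t → HasNonTh (app s t)

  data ThTm : ∀ {A} → Tm A → Set where
    tvar : ∀ {A} (x : Var A) → ThTm (var x)
    tfun : ∀ {A} {f : Fun A} → T (isTh f) → ThTm (fun f)
    tapp : ∀ {A B} {s : Tm (A ⇒ B)} {t : Tm A} → ThTm s → ThTm t → ThTm (app s t)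

  data GThTm : ∀ {A} → Tm A → Set where
    gfun : ∀ {A} {f : Fun A} → T (isTh f) → GThTm (fun f)
    gapp : ∀ {A B} {s : Tm (A ⇒ B)} {t : Tm A} → GThTm s → GThTm t → GThTm (app s t)

  ⟦_⟧ : ∀ {A} {t : Tm A} → GThTm t → TyI 𝔛 A
  ⟦ gfun {f = f} p ⟧ = interp f p
  ⟦ gapp g h ⟧       = ⟦ g ⟧ ⟦ h ⟧

  Holds : Tm (base bool) → Set
  Holds φ = Σ (GThTm φ) λ g → subst id 𝔛-bool ⟦ g ⟧ ≡ true

  LogicalConstraint : Tm (base bool) → Set
  LogicalConstraint φ = ThTm φ × (∀ {A} (x : Var A) → x ∈FV φ → IsThSortTy A)

  data Value : ∀ {A} → Tm A → Set where
    value : ∀ {S} (f : Fun (base S)) → T (isTh f) → Value (fun f)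

  data ThSpine : ∀ {A} → Tm A → Set where
    sfun : ∀ {A} {f : Fun A} → T (isTh f) → ThSpine (fun f)
    sapp : ∀ {A B} {s : Tm (A ⇒ B)} {t : Tm A} → ThSpine s → Value t → ThSpine (app s t)

  data _→κ_ {A : TyS} : Tm A → Tm A → Set where
    calc : ∀ {B S} (C : Ctx (base S) A) (s : Tm (B ⇒ base S)) (t : Tm B) (v' : Tm (base S)) →
           ThSpine (app s t) → Value v' →
           (g : GThTm (app s t)) (g' : GThTm v') → ⟦ g ⟧ ≡ ⟦ g' ⟧ →
           (C ⟨ app s t ⟩) →κ (C ⟨ v' ⟩)

  -- u is a →κ-normal form of t  (it is unique: u = t↓κ)
  κ-normal : ∀ {A} → Tm A → Set
  κ-normal {A} u = (w : Tm A) → ¬ (u →κ w)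

  _⇓κ_ : ∀ {A} → Tm A → Tm A → Set
  t ⇓κ u = Star _→κ_ t u × κ-normal u

  record Rule : Set where
    field
      ty          : TyS
      lhs rhs     : Tm ty
      constraint  : Tm (base bool)
      lc          : LogicalConstraint constraint
      fresh-th    : ∀ {A} (x : Var A) → x ∈FV rhs → ¬ (x ∈FV lhs) → IsThSortTy A
      lhs-head    : HeadFun lhs
      lhs-pattern : Pattern lhs
      lhs-nonth   : HasNonTh lhs

  ruleVars : Rule → VarSet
  ruleVars ρ x = x ∈FV Rule.constraint ρ ⊎ (x ∈FV Rule.rhs ρ × ¬ (x ∈FV Rule.lhs ρ))

  Respects : Subst → Rule → Set
  Respects σ ρ = (∀ {A} (x : Var A) → ruleVars ρ x → Value (σ x))
               × Holds (Rule.constraint ρ [ σ ])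

  data Step (ℛ : Rule → Set) {A : TyS} : Tm A → Tm A → Set where
    rule  : (ρ : Rule) → ℛ ρ → (σ : Subst) → Respects σ ρ → (C : Ctx (Rule.ty ρ) A) →
            Step ℛ (C ⟨ Rule.lhs ρ [ σ ] ⟩) (C ⟨ Rule.rhs ρ [ σ ] ⟩)
    kappa : ∀ {s t : Tm A} → s →κ t → Step ℛ s t

  RawCRel : Set₁
  RawCRel = ∀ {A} → Tm A → Tm A → Tm (base bool) → VarSet → Set

  IsConstrainedRelation : RawCRel → Set₁
  IsConstrainedRelation R =
    ∀ {A} {s t : Tm A} {φ : Tm (base bool)} {L : VarSet} → R s t φ L →
      LogicalConstraint φ
      × (∀ {B} (x : Var B) → x ∈FV φ → L x)
      × (∀ {B} (x : Var B) → L x → IsThSortTy B)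

  TermRel : Set₁
  TermRel = ∀ {A} → Tm A → Tm A → Set

  Monotonic : TermRel → Set
  Monotonic R = ∀ {A B} (C : Ctx B A) {s t : Tm B} → R s t → R (C ⟨ s ⟩) (C ⟨ t ⟩)

  IncludesKappa : TermRel → Set
  IncludesKappa R = ∀ {A} {s t : Tm A} → s →κ t → R s t

  Covers : TermRel → RawCRel → Set₁
  Covers R' R =
    ∀ {A} {s t : Tm A} {φ : Tm (base bool)} {L : VarSet} → R s t φ L →
      (σ : Subst) → (∀ {B} (x : Var B) → L x → GThTm (σ x)) → Holds (φ [ σ ]) →
      ∀ u u' → (s [ σ ]) ⇓κ u → (t [ σ ]) ⇓κ u' → R' u u'

record LCSTRS : Set₁ where
  field
    sig   : Signature
    rules : LCSTRSDefs.Rule sig → Set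

module Submission where

open import Defs
open import Data.Bool using (T)
open import Data.Bool.Properties using (T-irrelevant)
open import Data.Empty using (⊥-elim)
open import Data.Product using (Σ; _×_; _,_)
open import Data.Sum using (_⊎_; inj₁; inj₂)
open import Relation.Binary.Construct.Closure.ReflexiveTransitive
  using (Star; ε; _◅_; _◅◅_; gmap) renaming (map to map*)
open import Relation.Binary.PropositionalEquality using (_≡_; refl; sym; trans; cong; cong₂; subst; subst₂)
open import Relation.Nullary using (¬_; Dec; yes; no)
open import Relation.Nullary.Decidable.Core using (T?)

-- Every term has a κ-normal form (normalise the arguments, then calculate at
-- the root), and two calculation steps from the same term either coincide
-- (the interpretation is injective on values) or commute, so it is unique.
-- For a rule step C[ℓσ] → C[rσ], let a and b be the normal forms of ℓσ and
-- rσ.  Since ℓ contains a non-theory symbol, so does a, hence no calculation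
-- ever involves the position of the hole: normalising the rest of C gives a
-- context D with D[a] = C[ℓσ]↓κ.  Then D[a] ⊒ D[b] by coverage and
-- monotonicity, and D[b] →κ* C[rσ]↓κ with →κ ⊆ ⊒.

module Calculation (𝒮 : Signature) where
  open Signature 𝒮
  open LCSTRSDefs 𝒮

  -- →κ with the redex position given by the shape of the step, not by a context
  data _⇝_ : ∀ {A} → Tm A → Tm A → Set where
    root : ∀ {B S} {s : Tm (B ⇒ base S)} {t : Tm B} {v : Tm (base S)} →
           ThSpine (app s t) → Value v → (g : GThTm (app s t)) (g' : GThTm v) →
           ⟦ g ⟧ ≡ ⟦ g' ⟧ → app s t ⇝ v
    appˡ : ∀ {A B} {s s' : Tm (A ⇒ B)} {t : Tm A} → s ⇝ s' → app s t ⇝ app s' t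
    appʳ : ∀ {A B} {s : Tm (A ⇒ B)} {t t' : Tm A} → t ⇝ t' → app s t ⇝ app s t'

  infix 4 _⇝_ _⇝*_

  _⇝*_ : ∀ {A} → Tm A → Tm A → Set
  _⇝*_ = Star _⇝_

  ⇝-Normal : ∀ {A} → Tm A → Set
  ⇝-Normal {A} u = (w : Tm A) → ¬ (u ⇝ w)

  ⇝-ctx : ∀ {A B} (C : Ctx B A) {s t : Tm B} → s ⇝ t → C ⟨ s ⟩ ⇝ C ⟨ t ⟩
  ⇝-ctx □          st = st
  ⇝-ctx (appˡ C t) st = appˡ (⇝-ctx C st)
  ⇝-ctx (appʳ s C) st = appʳ (⇝-ctx C st)

  ⇝*-ctx : ∀ {A B} (C : Ctx B A) {s t : Tm B} → s ⇝* t → C ⟨ s ⟩ ⇝* C ⟨ t ⟩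
  ⇝*-ctx C = gmap (C ⟨_⟩) (⇝-ctx C)

  ⇝*-appˡ : ∀ {A B} {s s' : Tm (A ⇒ B)} (t : Tm A) → s ⇝* s' → app s t ⇝* app s' t
  ⇝*-appˡ t = ⇝*-ctx (appˡ □ t)

  ⇝*-appʳ : ∀ {A B} (s : Tm (A ⇒ B)) {t t' : Tm A} → t ⇝* t' → app s t ⇝* app s t'
  ⇝*-appʳ s = ⇝*-ctx (appʳ s □)

  →κ⇒⇝ : ∀ {A} {s t : Tm A} → s →κ t → s ⇝ t
  →κ⇒⇝ (calc C _ _ _ sp v g g' eq) = ⇝-ctx C (root sp v g g' eq)

  ⇝⇒→κ : ∀ {A} {s t : Tm A} → s ⇝ t → s →κ t
  ⇝⇒→κ (root sp v g g' eq) = calc □ _ _ _ sp v g g' eq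
  ⇝⇒→κ (appˡ {t = t} st) with ⇝⇒→κ st
  ... | calc C s u v' sp v g g' eq = calc (appˡ C t) s u v' sp v g g' eq
  ⇝⇒→κ (appʳ {s = s} st) with ⇝⇒→κ st
  ... | calc C s' u v' sp v g g' eq = calc (appʳ s C) s' u v' sp v g g' eq

  →κ*⇒⇝* : ∀ {A} {s t : Tm A} → Star _→κ_ s t → s ⇝* t
  →κ*⇒⇝* = map* →κ⇒⇝

  ⇝*⇒→κ* : ∀ {A} {s t : Tm A} → s ⇝* t → Star _→κ_ s t
  ⇝*⇒→κ* = map* ⇝⇒→κ

  κ-normal⇒⇝-Normal : ∀ {A} {u : Tm A} → κ-normal u → ⇝-Normal u
  κ-normal⇒⇝-Normal n w st = n w (⇝⇒→κ st)

  ⇝-Normal⇒κ-normal : ∀ {A} {u : Tm A} → ⇝-Normal u → κ-normal u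
  ⇝-Normal⇒κ-normal n w st = n w (→κ⇒⇝ st)

  ⟦⟧-irrelevant : ∀ {A} {t : Tm A} (g h : GThTm t) → ⟦ g ⟧ ≡ ⟦ h ⟧
  ⟦⟧-irrelevant (gfun {f = f} p) (gfun q) = cong (interp f) (T-irrelevant p q)
  ⟦⟧-irrelevant (gapp g₁ g₂) (gapp h₁ h₂) =
    cong₂ (λ f x → f x) (⟦⟧-irrelevant g₁ h₁) (⟦⟧-irrelevant g₂ h₂)

  ThType-codomain : ∀ A B → ThType isThSort (A ⇒ B) → ThType isThSort B
  ThType-codomain (base S) B (_ , th) = th

  ThSpine-ThType : ∀ {A} {t : Tm A} → ThSpine t → ThType isThSort A
  ThSpine-ThType (sfun {f = f} p)     = th-type f p
  ThSpine-ThType (sapp {A} {B} sp _) = ThType-codomain A B (ThSpine-ThType sp)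

  ThSpine-ground : ∀ {A} {t : Tm A} → ThSpine t → GThTm t
  ThSpine-ground (sfun p)              = gfun p
  ThSpine-ground (sapp sp (value f p)) = gapp (ThSpine-ground sp) (gfun p)

  Value-ground : ∀ {A} {t : Tm A} → Value t → GThTm t
  Value-ground (value f p) = gfun p

  Value-⇝-Normal : ∀ {A} {t : Tm A} → Value t → ⇝-Normal t
  Value-⇝-Normal (value f p) _ ()

  ThSpine⇒-⇝-Normal : ∀ {A B} {s : Tm (A ⇒ B)} → ThSpine s → ⇝-Normal s
  ThSpine⇒-⇝-Normal (sfun p)    _ ()
  ThSpine⇒-⇝-Normal (sapp sp v) _ (appˡ st) = ThSpine⇒-⇝-Normal sp _ st
  ThSpine⇒-⇝-Normal (sapp sp v) _ (appʳ st) = Value-⇝-Normal v _ st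

  root-deterministic : ∀ {S} {t v v' : Tm (base S)} → ThSpine t →
    (g g₁ : GThTm t) → Value v → Value v' → (h : GThTm v) (h' : GThTm v') →
    ⟦ g ⟧ ≡ ⟦ h ⟧ → ⟦ g₁ ⟧ ≡ ⟦ h' ⟧ → v ≡ v'
  root-deterministic sp g g₁ (value f _) (value f' _) (gfun q) (gfun q') eq eq' =
    cong fun (interp-inj (ThSpine-ThType sp) f f' q q'
      (trans (sym eq) (trans (⟦⟧-irrelevant g g₁) eq')))

  ⇝-diamond : ∀ {A} {t s s' : Tm A} → t ⇝ s → t ⇝ s' →
              s ≡ s' ⊎ Σ (Tm A) (λ w → s ⇝ w × s' ⇝ w)
  ⇝-diamond (root sp v g h eq) (root _ v' g₁ h' eq') =
    inj₁ (root-deterministic sp g g₁ v v' h h' eq eq')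
  ⇝-diamond (root (sapp sp _) _ _ _ _) (appˡ st) = ⊥-elim (ThSpine⇒-⇝-Normal sp _ st)
  ⇝-diamond (root (sapp _ v) _ _ _ _)  (appʳ st) = ⊥-elim (Value-⇝-Normal v _ st)
  ⇝-diamond (appˡ st) (root (sapp sp _) _ _ _ _) = ⊥-elim (ThSpine⇒-⇝-Normal sp _ st)
  ⇝-diamond (appʳ st) (root (sapp _ v) _ _ _ _)  = ⊥-elim (Value-⇝-Normal v _ st)
  ⇝-diamond (appˡ st) (appʳ st') = inj₂ (_ , appʳ st' , appˡ st)
  ⇝-diamond (appʳ st) (appˡ st') = inj₂ (_ , appˡ st' , appʳ st)
  ⇝-diamond (appˡ {t = t} st) (appˡ st') with ⇝-diamond st st'
  ... | inj₁ eq            = inj₁ (cong (λ s → app s t) eq)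
  ... | inj₂ (w , p , p')  = inj₂ (app w t , appˡ p , appˡ p')
  ⇝-diamond (appʳ {s = s} st) (appʳ st') with ⇝-diamond st st'
  ... | inj₁ eq            = inj₁ (cong (app s) eq)
  ... | inj₂ (w , p , p')  = inj₂ (app s w , appʳ p , appʳ p')

  ⇝-strip : ∀ {A} {t s s' : Tm A} → t ⇝ s → t ⇝* s' →
            Σ (Tm A) (λ w → s ⇝* w × (s' ≡ w ⊎ s' ⇝ w))
  ⇝-strip st ε = _ , ε , inj₂ st
  ⇝-strip st (st' ◅ sts') with ⇝-diamond st st'
  ... | inj₁ refl = _ , sts' , inj₁ refl
  ... | inj₂ (w , p , p') with ⇝-strip p' sts'
  ...   | w' , q , q' = w' , p ◅ q , q'

  ⇝-normal-form-unique : ∀ {A} {t u u' : Tm A} →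
    t ⇝* u → ⇝-Normal u → t ⇝* u' → ⇝-Normal u' → u ≡ u'
  ⇝-normal-form-unique ε        _ ε         _  = refl
  ⇝-normal-form-unique ε        n (st ◅ _)  _  = ⊥-elim (n _ st)
  ⇝-normal-form-unique (st ◅ sts) n sts' n' with ⇝-strip st sts'
  ... | _ , q , inj₁ refl = ⇝-normal-form-unique sts n q n'
  ... | _ , _ , inj₂ st'  = ⊥-elim (n' _ st')

  value? : ∀ {A} (t : Tm A) → Dec (Value t)
  value? (var x)           = no λ ()
  value? (app s t)         = no λ ()
  value? {_ ⇒ _} (fun f)   = no λ ()
  value? {base S} (fun f) with T? (isTh f)
  ... | yes p = yes (value f p)
  ... | no ¬p = no λ { (value _ p) → ¬p p }

  thSpine? : ∀ {A} (t : Tm A) → Dec (ThSpine t)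
  thSpine? (var x) = no λ ()
  thSpine? (fun f) with T? (isTh f)
  ... | yes p = yes (sfun p)
  ... | no ¬p = no λ { (sfun p) → ¬p p }
  thSpine? (app s t) with thSpine? s | value? t
  ... | yes sp | yes v = yes (sapp sp v)
  ... | no ¬sp | _     = no λ { (sapp sp _) → ¬sp sp }
  ... | _      | no ¬v = no λ { (sapp _ v) → ¬v v }

  app-normal-or-root : ∀ {B} A (s : Tm (B ⇒ A)) (t : Tm B) → ⇝-Normal s → ⇝-Normal t →
    Σ (Tm A) (λ v → app s t ⇝ v × ⇝-Normal v) ⊎ ⇝-Normal (app s t)
  app-normal-or-root (_ ⇒ _) s t ns nt =
    inj₂ λ { _ (appˡ st) → ns _ st ; _ (appʳ st) → nt _ st }
  app-normal-or-root (base S) s t ns nt with thSpine? (app s t)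
  ... | yes sp with interp-surj (ThSpine-ThType sp) ⟦ ThSpine-ground sp ⟧
  ...   | f , p , eq =
          inj₁ (fun f , root sp (value f p) (ThSpine-ground sp) (gfun p) (sym eq) , λ _ ())
  app-normal-or-root (base S) s t ns nt | no ¬sp =
    inj₂ λ { _ (root sp _ _ _ _) → ¬sp sp ; _ (appˡ st) → ns _ st ; _ (appʳ st) → nt _ st }

  ⇝-normalise : ∀ {A} (t : Tm A) → Σ (Tm A) (λ u → t ⇝* u × ⇝-Normal u)
  ⇝-normalise (var x) = var x , ε , λ _ ()
  ⇝-normalise (fun f) = fun f , ε , λ _ ()
  ⇝-normalise {A} (app s t) with ⇝-normalise s | ⇝-normalise t
  ... | s' , s⇝*s' , ns | t' , t⇝*t' , nt with app-normal-or-root A s' t' ns nt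
  ...   | inj₁ (v , st , nv) = v , (⇝*-appˡ t s⇝*s' ◅◅ ⇝*-appʳ s' t⇝*t' ◅◅ st ◅ ε) , nv
  ...   | inj₂ n = app s' t' , (⇝*-appˡ t s⇝*s' ◅◅ ⇝*-appʳ s' t⇝*t') , n

  ThSpine-¬HasNonTh : ∀ {A} {t : Tm A} → ThSpine t → ¬ HasNonTh t
  Value-¬HasNonTh   : ∀ {A} {t : Tm A} → Value t → ¬ HasNonTh t
  ThSpine-¬HasNonTh (sfun p)    (nfun f eq) = subst T eq p
  ThSpine-¬HasNonTh (sapp sp v) (nleft h)   = ThSpine-¬HasNonTh sp h
  ThSpine-¬HasNonTh (sapp sp v) (nright h)  = Value-¬HasNonTh v h
  Value-¬HasNonTh (value f p) (nfun f eq)   = subst T eq p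

  HasNonTh-[] : ∀ {A} {t : Tm A} (σ : Subst) → HasNonTh t → HasNonTh (t [ σ ])
  HasNonTh-[] σ (nfun f eq) = nfun f eq
  HasNonTh-[] σ (nleft h)   = nleft (HasNonTh-[] σ h)
  HasNonTh-[] σ (nright h)  = nright (HasNonTh-[] σ h)

  HasNonTh-⇝ : ∀ {A} {t t' : Tm A} → t ⇝ t' → HasNonTh t → HasNonTh t'
  HasNonTh-⇝ (root sp _ _ _ _) h          = ⊥-elim (ThSpine-¬HasNonTh sp h)
  HasNonTh-⇝ (appˡ st)         (nleft h)  = nleft (HasNonTh-⇝ st h)
  HasNonTh-⇝ (appˡ st)         (nright h) = nright h
  HasNonTh-⇝ (appʳ st)         (nleft h)  = nleft h
  HasNonTh-⇝ (appʳ st)         (nright h) = nright (HasNonTh-⇝ st h)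

  HasNonTh-⇝* : ∀ {A} {t t' : Tm A} → t ⇝* t' → HasNonTh t → HasNonTh t'
  HasNonTh-⇝* ε          h = h
  HasNonTh-⇝* (st ◅ sts) h = HasNonTh-⇝* sts (HasNonTh-⇝ st h)

  HasNonTh-ctx : ∀ {A B} (C : Ctx B A) {t : Tm B} → HasNonTh t → HasNonTh (C ⟨ t ⟩)
  HasNonTh-ctx □          h = h
  HasNonTh-ctx (appˡ C t) h = nleft (HasNonTh-ctx C h)
  HasNonTh-ctx (appʳ s C) h = nright (HasNonTh-ctx C h)

  -- D is C with every argument beside the path to the hole normalised; no root
  -- step can fire along that path because the plug a is not a theory term
  normalise-ctx : ∀ {A B} (C : Ctx B A) (a b : Tm B) → ⇝-Normal a → HasNonTh a →
    Σ (Ctx B A) λ D → C ⟨ a ⟩ ⇝* D ⟨ a ⟩ × C ⟨ b ⟩ ⇝* D ⟨ b ⟩ × ⇝-Normal (D ⟨ a ⟩)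
  normalise-ctx □ a b na ha = □ , ε , ε , na
  normalise-ctx (appˡ C t) a b na ha with normalise-ctx C a b na ha | ⇝-normalise t
  ... | D , Ca⇝*Da , Cb⇝*Db , nDa | t' , t⇝*t' , nt =
    appˡ D t' ,
    ⇝*-appˡ t Ca⇝*Da ◅◅ ⇝*-appʳ (D ⟨ a ⟩) t⇝*t' ,
    ⇝*-appˡ t Cb⇝*Db ◅◅ ⇝*-appʳ (D ⟨ b ⟩) t⇝*t' ,
    λ { _ (root (sapp sp _) _ _ _ _) → ThSpine-¬HasNonTh sp (HasNonTh-ctx D ha)
      ; _ (appˡ st) → nDa _ st
      ; _ (appʳ st) → nt _ st }
  normalise-ctx (appʳ s C) a b na ha with normalise-ctx C a b na ha | ⇝-normalise s
  ... | D , Ca⇝*Da , Cb⇝*Db , nDa | s' , s⇝*s' , ns =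
    appʳ s' D ,
    ⇝*-appˡ (C ⟨ a ⟩) s⇝*s' ◅◅ ⇝*-appʳ s' Ca⇝*Da ,
    ⇝*-appˡ (C ⟨ b ⟩) s⇝*s' ◅◅ ⇝*-appʳ s' Cb⇝*Db ,
    λ { _ (root (sapp _ v) _ _ _ _) → Value-¬HasNonTh v (HasNonTh-ctx D ha)
      ; _ (appˡ st) → ns _ st
      ; _ (appʳ st) → nDa _ st }

  ⇓κ-unique : ∀ {A} {t u u' : Tm A} → t ⇓κ u → t ⇓κ u' → u ≡ u'
  ⇓κ-unique (t→u , nu) (t→u' , nu') =
    ⇝-normal-form-unique (→κ*⇒⇝* t→u) (κ-normal⇒⇝-Normal nu)
                         (→κ*⇒⇝* t→u') (κ-normal⇒⇝-Normal nu')

  ⇝-Normal-⇓κ : ∀ {A} {t u : Tm A} → t ⇝* u → ⇝-Normal u → t ⇓κ u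
  ⇝-Normal-⇓κ t⇝*u nu = ⇝*⇒→κ* t⇝*u , ⇝-Normal⇒κ-normal nu

  →κ-⇓κ : ∀ {A} {t t' u : Tm A} → t →κ t' → t' ⇓κ u → t ⇓κ u
  →κ-⇓κ st (t'→u , nu) = st ◅ t'→u , nu

  module _ (rules : Rule → Set) (≿ : RawCRel)
           (rules-oriented : ∀ (ρ : Rule) → rules ρ →
              ≿ (Rule.lhs ρ) (Rule.rhs ρ) (Rule.constraint ρ) (ruleVars ρ))
           (⊒ : TermRel) (⊒-mono : Monotonic ⊒) (κ⊆⊒ : IncludesKappa ⊒)
           (⊒-covers : Covers ⊒ ≿) where

    rule-step-⊒* : (ρ : Rule) → rules ρ → (σ : Subst) → Respects σ ρ →
      ∀ {A} (C : Ctx (Rule.ty ρ) A) {u u' : Tm A} →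
      (C ⟨ Rule.lhs ρ [ σ ] ⟩) ⇓κ u → (C ⟨ Rule.rhs ρ [ σ ] ⟩) ⇓κ u' → Star ⊒ u u'
    rule-step-⊒* ρ ρ∈ σ (σ-values , φσ-holds) C Cℓ⇓u Cr⇓u'
      with ⇝-normalise (Rule.lhs ρ [ σ ]) | ⇝-normalise (Rule.rhs ρ [ σ ])
    ... | a , ℓσ⇝*a , na | b , rσ⇝*b , nb
      with normalise-ctx C a b na (HasNonTh-⇝* ℓσ⇝*a (HasNonTh-[] σ (Rule.lhs-nonth ρ)))
    ... | D , Ca⇝*Da , Cb⇝*Db , nDa with ⇝-normalise (D ⟨ b ⟩)
    ... | v , Db⇝*v , nv =
      subst₂ (Star ⊒) (⇓κ-unique Cℓ⇓Da Cℓ⇓u) (⇓κ-unique Cr⇓v Cr⇓u')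
        (⊒-mono D a⊒b ◅ map* (λ st → κ⊆⊒ (⇝⇒→κ st)) Db⇝*v)
      where
      a⊒b : ⊒ a b
      a⊒b = ⊒-covers (rules-oriented ρ ρ∈) σ (λ x x∈ → Value-ground (σ-values x x∈))
              φσ-holds a b (⇝-Normal-⇓κ ℓσ⇝*a na) (⇝-Normal-⇓κ rσ⇝*b nb)
      Cℓ⇓Da : (C ⟨ Rule.lhs ρ [ σ ] ⟩) ⇓κ (D ⟨ a ⟩)
      Cℓ⇓Da = ⇝-Normal-⇓κ (⇝*-ctx C ℓσ⇝*a ◅◅ Ca⇝*Da) nDa
      Cr⇓v : (C ⟨ Rule.rhs ρ [ σ ] ⟩) ⇓κ v
      Cr⇓v = ⇝-Normal-⇓κ (⇝*-ctx C rσ⇝*b ◅◅ Cb⇝*Db ◅◅ Db⇝*v) nv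

lemma45 : (ℛ : LCSTRS) → let open LCSTRS ℛ in let open LCSTRSDefs sig in
    (≿ : RawCRel) → IsConstrainedRelation ≿ →
    (∀ (ρ : Rule) → rules ρ →
       ≿ (Rule.lhs ρ) (Rule.rhs ρ) (Rule.constraint ρ) (ruleVars ρ)) →
    (⊒ : TermRel) → Monotonic ⊒ → IncludesKappa ⊒ → Covers ⊒ ≿ →
    ∀ {A} {t t' : Tm A} → Step rules t t' →
    ∀ u u' → t ⇓κ u → t' ⇓κ u' → Star (⊒ {A}) u u'
lemma45 ℛ ≿ _ oriented ⊒ mono κ⊆⊒ covers (LCSTRSDefs.rule ρ ρ∈ σ resp C) _ _ t⇓u t'⇓u' =
  Calculation.rule-step-⊒* (LCSTRS.sig ℛ) (LCSTRS.rules ℛ) ≿ oriented ⊒ mono κ⊆⊒ covers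
    ρ ρ∈ σ resp C t⇓u t'⇓u'
lemma45 ℛ _ _ _ ⊒ _ _ _ (LCSTRSDefs.kappa st) u _ t⇓u t'⇓u' =
  subst (Star ⊒ u) (⇓κ-unique t⇓u (→κ-⇓κ st t'⇓u')) ε
  where open Calculation (LCSTRS.sig ℛ)
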